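{- Let $q \in \mathbb{Q}^+$ be written as the irreducible fraction $q = \frac{c}{d}$ with $c,d$ positive integers. Let $\mathcal{W}_q$ be the set of all finite binary words $w$ (of any length $n \ge 0$, including the empty word) such that for every maximal factor of $w$ of the form $0^a1^b$ with $a > 0$ one has $aq > b$. Let $w_{r,i}$ be the number of words in $\mathcal{W}_q$ containing exactly $r$ zeros and $i$ ones, and let $W_q(y,z) = \sum_{r=0}^\infty \sum_{i=0}^\infty w_{r,i} z^r y^i$. Then, as formal power series, $$W_q(y,z) = \frac{1 - z^d y^c}{(1-y)\big(1 - z^d y^c - P_q(y,z)\big)}, \qquad \text{where } P_q(y,z) = \sum_{i=0}^{c-1} z^{1+\lfloor i/q \rfloor} y^i .$$
   Context: Here $x^\ell$ denotes the word consisting of $\ell$ copies of the symbol $x$. A maximal factor of the form $0^a1^b$ means a maximal run of $a$ consecutive zeros followed immediately by the maximal run of $b \ge 0$ consecutive ones that follows it (so e.g. a word ending in $0^a$ has the factor $0^a1^0$). The polynomial $P_q(y,z)$ is called the model polynomial of $q$. -}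

module Defs where

open import Data.Bool using (Bool; true; false)
open import Data.Nat as ℕ using (ℕ; zero; suc; _<_; _<?_; NonZero)
open import Data.Nat.DivMod using (_/_)
open import Data.Integer as ℤ using (ℤ; +_)
open import Data.List using (List; []; _∷_; length; filter; map; concatMap)
open import Data.List.Relation.Unary.All using (All; all?)
open import Data.Product using (_×_; _,_)
open import Data.Product.Properties using ()
open import Relation.Binary.PropositionalEquality using (_≡_)
open import Relation.Nullary using (Dec; yes; no)
open import Relation.Nullary.Decidable using (_×-dec_)

-- Binary words: false = symbol 0, true = symbol 1.
Word : Set
Word = List Bool

allWords : ℕ → List Word
allWords zero = [] ∷ []
allWords (suc n) = concatMap (λ w → (false ∷ w) ∷ (true ∷ w) ∷ []) (allWords n)

#0 : Word → ℕ
#0 [] = 0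
#0 (false ∷ w) = suc (#0 w)
#0 (true ∷ w) = #0 w

#1 : Word → ℕ
#1 [] = 0
#1 (false ∷ w) = #1 w
#1 (true ∷ w) = suc (#1 w)

-- Maximal factors 0^a 1^b with a > 0, listed as pairs (a , b), left to right.
mutual
  inZeros : ℕ → Word → List (ℕ × ℕ)
  inZeros a [] = (a , 0) ∷ []
  inZeros a (false ∷ w) = inZeros (suc a) w
  inZeros a (true ∷ w) = inOnes a 1 w

  inOnes : ℕ → ℕ → Word → List (ℕ × ℕ)
  inOnes a b [] = (a , b) ∷ []
  inOnes a b (true ∷ w) = inOnes a (suc b) w
  inOnes a b (false ∷ w) = (a , b) ∷ inZeros 1 w

maxFactors : Word → List (ℕ × ℕ)
maxFactors [] = []
maxFactors (true ∷ w) = maxFactors w   -- leading ones belong to no factor with a > 0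
maxFactors (false ∷ w) = inZeros 1 w

-- With q = c / d, the condition a q > b reads b * d < a * c.
GoodFactor : ℕ → ℕ → ℕ × ℕ → Set
GoodFactor c d (a , b) = b ℕ.* d < a ℕ.* c

InW : ℕ → ℕ → Word → Set
InW c d w = All (GoodFactor c d) (maxFactors w)

InW? : ∀ c d w → Dec (InW c d w)
InW? c d w = all? (λ { (a , b) → (b ℕ.* d) <? (a ℕ.* c) }) (maxFactors w)

wCount : ℕ → ℕ → ℕ → ℕ → ℕ
wCount c d r i =
  length (filter (λ w → InW? c d w ×-dec ((#0 w ℕ.≟ r) ×-dec (#1 w ℕ.≟ i)))
                 (allWords (r ℕ.+ i)))

-- Formal power series in z, y over ℤ:  F r i = coefficient of z^r y^i.

PS : Set
PS = ℕ → ℕ → ℤ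

sumℤ : ℕ → (ℕ → ℤ) → ℤ
sumℤ zero f = + 0
sumℤ (suc n) f = sumℤ n f ℤ.+ f n

_⊕_ : PS → PS → PS
(F ⊕ G) r i = F r i ℤ.+ G r i

⊖_ : PS → PS
(⊖ F) r i = ℤ.- (F r i)

_⊝_ : PS → PS → PS
F ⊝ G = F ⊕ (⊖ G)

_⊛_ : PS → PS → PS
(F ⊛ G) r i = sumℤ (suc r) (λ j → sumℤ (suc i) (λ k →
                 F j k ℤ.* G (r ℕ.∸ j) (i ℕ.∸ k)))

sumPS : ℕ → (ℕ → PS) → PS
sumPS zero F r i = + 0
sumPS (suc n) F = sumPS n F ⊕ F n

mono : ℕ → ℕ → PS
mono m n r i with r ℕ.≟ m | i ℕ.≟ n
... | yes _ | yes _ = + 1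
... | _     | _     = + 0

one : PS
one = mono 0 0

yPS : PS
yPS = mono 0 1

Wq : ℕ → ℕ → PS
Wq c d r i = + (wCount c d r i)

-- model polynomial P_q(y,z) = Σ_{i=0}^{c-1} z^{1 + ⌊i/q⌋} y^i, with ⌊i/q⌋ = ⌊i d / c⌋
Pq : (c d : ℕ) → .{{NonZero c}} → PS
Pq c d = sumPS c (λ i → mono (suc ((i ℕ.* d) / c)) i)

-- Reading a word left to right, the state after each letter is the maximal factor 0^a 1^b
-- currently being read.  The generating series of the admissible continuations from each
-- state satisfy linear recursions, and since every step of a recursion raises the degree in z
-- or in y, they determine these series uniquely.  Solving them gives (1 - y) W = U with
-- U = 1 + z Z₁ and Z₁ = 1/(1 - z) + Q U, where Q = Σ [0 < j ∧ j d < (1 + e) c] z^e y^j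
-- records the good factors 0^(1+e) 1^j.  Since ⌊(c + j)/q⌋ = d + ⌊j/q⌋, multiplying Q by
-- (1 - z)(1 - z^d y^c) leaves only the lattice points (⌊j/q⌋, j) with 0 < j ≤ c, that is
-- z (1 - z)(1 - z^d y^c) Q = P_q - z + z^(d+1) y^c.  Eliminating Z₁ and Q in the ring of
-- power series then yields U (1 - z^d y^c - P_q) = 1 - z^d y^c.

{-# OPTIONS --safe #-}
module Submission where

open import Defs
open import Algebra.Bundles using (CommutativeRing)
import Algebra.Properties.CommutativeSemigroup as CSP
open import Data.Bool using (Bool; true; false; _∧_; if_then_else_)
open import Data.Bool.ListAction using (all)
open import Data.Bool.Properties using (∧-zeroʳ; ∧-identityʳ)
open import Data.Integer as ℤ using (ℤ; +_; -[1+_]; _+_; _*_; -_; _-_)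
import Data.Integer.Properties as ℤP
open import Data.List using (List; []; _∷_; length; filter; concatMap)
open import Data.List.Relation.Unary.All using (all?)
open import Data.Nat as ℕ
  using (ℕ; zero; suc; _∸_; NonZero; _≤_; _<_; s≤s; _≤ᵇ_; _<ᵇ_; _≡ᵇ_)
open import Data.Nat.Coprimality using (Coprime)
open import Data.Nat.Divisibility using (m∣m*n)
open import Data.Nat.DivMod
  using (_/_; _%_; m≡m%n+[m/n]*n; m%n<n; m<n*o⇒m/o<n; /-congˡ; +-distrib-/-∣ˡ; m*n/n≡m; 0/n≡0)
import Data.Nat.Properties as ℕP
open import Data.Product using (_×_; _,_)
open import Function using (_∘_; _⇔_; mk⇔)
open import Level using (0ℓ)
open import Relation.Binary.PropositionalEquality
  using (_≡_; _≢_; refl; sym; trans; cong; cong₂; subst; module ≡-Reasoning)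
import Relation.Binary.Reasoning.Setoid
open import Relation.Nullary using (¬_; yes; no; does; contradiction)
open import Relation.Nullary.Decidable using (dec-true; dec-false; does-⇔; _×-dec_)
open import Relation.Unary using (Decidable)

open CSP ℤP.+-commutativeSemigroup using (interchange)

sum-cong : ∀ n {f g : ℕ → ℤ} → (∀ k → k < n → f k ≡ g k) → sumℤ n f ≡ sumℤ n g
sum-cong zero    eq = refl
sum-cong (suc n) eq = cong₂ _+_ (sum-cong n (λ k k<n → eq k (ℕP.m<n⇒m<1+n k<n))) (eq n ℕP.≤-refl)

sum-+ : ∀ n (f g : ℕ → ℤ) → sumℤ n (λ k → f k + g k) ≡ sumℤ n f + sumℤ n g
sum-+ zero    f g = refl
sum-+ (suc n) f g =
  trans (cong (_+ (f n + g n)) (sum-+ n f g)) (interchange (sumℤ n f) (sumℤ n g) (f n) (g n))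

*-distribˡ-sum : ∀ n a (f : ℕ → ℤ) → a * sumℤ n f ≡ sumℤ n (λ k → a * f k)
*-distribˡ-sum zero    a f = ℤP.*-zeroʳ a
*-distribˡ-sum (suc n) a f =
  trans (ℤP.*-distribˡ-+ a (sumℤ n f) (f n)) (cong (_+ a * f n) (*-distribˡ-sum n a f))

*-distribʳ-sum : ∀ n a (f : ℕ → ℤ) → sumℤ n f * a ≡ sumℤ n (λ k → f k * a)
*-distribʳ-sum n a f =
  trans (ℤP.*-comm (sumℤ n f) a) (trans (*-distribˡ-sum n a f) (sum-cong n (λ k _ → ℤP.*-comm a (f k))))

sum-zero : ∀ n {f : ℕ → ℤ} → (∀ k → k < n → f k ≡ + 0) → sumℤ n f ≡ + 0
sum-zero zero    eq = refl
sum-zero (suc n) eq = cong₂ _+_ (sum-zero n (λ k k<n → eq k (ℕP.m<n⇒m<1+n k<n))) (eq n ℕP.≤-refl)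

sum-single : ∀ n m {f : ℕ → ℤ} → m < n → (∀ k → k < n → k ≢ m → f k ≡ + 0) →
             sumℤ n f ≡ f m
sum-single (suc n) m {f} m<1+n eq with m ℕ.≟ n
... | yes refl =
  trans (cong (_+ f m) (sum-zero n (λ k k<n → eq k (ℕP.m<n⇒m<1+n k<n) (ℕP.<⇒≢ k<n))))
        (ℤP.+-identityˡ (f m))
... | no m≢n =
  trans (cong₂ _+_ (sum-single n m (ℕP.≤∧≢⇒< (ℕP.≤-pred m<1+n) m≢n)
                                  (λ k k<n → eq k (ℕP.m<n⇒m<1+n k<n)))
                   (eq n ℕP.≤-refl (m≢n ∘ sym)))
        (ℤP.+-identityʳ (f m))

sum-comm : ∀ m n (f : ℕ → ℕ → ℤ) →
           sumℤ m (λ j → sumℤ n (f j)) ≡ sumℤ n (λ k → sumℤ m (λ j → f j k))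
sum-comm zero    n f = sym (sum-zero n (λ _ _ → refl))
sum-comm (suc m) n f =
  trans (cong (_+ sumℤ n (f m)) (sum-comm m n f)) (sym (sum-+ n (λ k → sumℤ m (λ j → f j k)) (f m)))

sum-shiftˡ : ∀ n (f : ℕ → ℤ) → sumℤ (suc n) f ≡ f 0 + sumℤ n (f ∘ suc)
sum-shiftˡ zero    f = trans (ℤP.+-identityˡ (f 0)) (sym (ℤP.+-identityʳ (f 0)))
sum-shiftˡ (suc n) f = trans (cong (_+ f (suc n)) (sum-shiftˡ n f)) (ℤP.+-assoc (f 0) _ _)

sum-reverse : ∀ n (f : ℕ → ℤ) → sumℤ (suc n) f ≡ sumℤ (suc n) (λ k → f (n ∸ k))
sum-reverse zero    f = refl
sum-reverse (suc n) f = begin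
  sumℤ (suc n) f + f (suc n)                   ≡⟨ cong (_+ f (suc n)) (sum-reverse n f) ⟩
  sumℤ (suc n) (λ k → f (n ∸ k)) + f (suc n)   ≡⟨ ℤP.+-comm _ (f (suc n)) ⟩
  f (suc n) + sumℤ (suc n) (λ k → f (n ∸ k))   ≡⟨ sym (sum-shiftˡ (suc n) (λ k → f (suc n ∸ k))) ⟩
  sumℤ (suc (suc n)) (λ k → f (suc n ∸ k))     ∎
  where open ≡-Reasoning

sum-triangle : ∀ r (f : ℕ → ℕ → ℤ) →
  sumℤ (suc r) (λ j → sumℤ (suc (r ∸ j)) (f j)) ≡
  sumℤ (suc r) (λ s → sumℤ (suc s) (λ j → f j (s ∸ j)))
sum-triangle zero    f = refl
sum-triangle (suc r) f = begin
  sumℤ (suc r) (λ j → sumℤ (suc (suc r ∸ j)) (f j)) + sumℤ (suc (r ∸ r)) (f (suc r))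
    ≡⟨ cong₂ _+_ (sum-cong (suc r) (λ j j≤r → cong (λ t → sumℤ (suc t) (f j)) (suc-∸ j≤r)))
                 (cong (λ t → sumℤ (suc t) (f (suc r))) (ℕP.n∸n≡0 r)) ⟩
  sumℤ (suc r) (λ j → sumℤ (suc (r ∸ j)) (f j) + f j (suc (r ∸ j))) + (+ 0 + f (suc r) 0)
    ≡⟨ cong₂ _+_ (sum-+ (suc r) _ _) (ℤP.+-identityˡ _) ⟩
  (sumℤ (suc r) (λ j → sumℤ (suc (r ∸ j)) (f j)) + sumℤ (suc r) (λ j → f j (suc (r ∸ j)))) + f (suc r) 0
    ≡⟨ cong₂ (λ a b → (a + b) + f (suc r) 0)
             (sum-triangle r f) (sum-cong (suc r) (λ j j≤r → cong (f j) (sym (suc-∸ j≤r)))) ⟩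
  (S + sumℤ (suc r) (λ j → f j (suc r ∸ j))) + f (suc r) 0
    ≡⟨ ℤP.+-assoc S _ _ ⟩
  S + (sumℤ (suc r) (λ j → f j (suc r ∸ j)) + f (suc r) 0)
    ≡⟨ cong (λ t → S + (sumℤ (suc r) (λ j → f j (suc r ∸ j)) + f (suc r) t)) (sym (ℕP.n∸n≡0 r)) ⟩
  S + (sumℤ (suc r) (λ j → f j (suc r ∸ j)) + f (suc r) (r ∸ r)) ∎
  where
  open ≡-Reasoning
  S : ℤ
  S = sumℤ (suc r) (λ s → sumℤ (suc s) (λ j → f j (s ∸ j)))
  suc-∸ : ∀ {j} → j < suc r → suc r ∸ j ≡ suc (r ∸ j)
  suc-∸ j≤r = ℕP.+-∸-assoc 1 (ℕP.≤-pred j≤r)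

infix 4 _≈_
_≈_ : PS → PS → Set
F ≈ G = ∀ r i → F r i ≡ G r i

0PS : PS
0PS r i = + 0

z : PS
z = mono 1 0

shift : ℕ → ℕ → PS → PS
shift m n F r i with m ℕ.≤? r | n ℕ.≤? i
... | yes _ | yes _ = F (r ∸ m) (i ∸ n)
... | _     | _     = + 0

⊛-cong : ∀ {F F′ G G′} → F ≈ F′ → G ≈ G′ → F ⊛ G ≈ F′ ⊛ G′
⊛-cong F≈F′ G≈G′ r i =
  sum-cong (suc r) (λ j _ → sum-cong (suc i) (λ k _ → cong₂ _*_ (F≈F′ j k) (G≈G′ (r ∸ j) (i ∸ k))))

⊛-comm : ∀ F G → F ⊛ G ≈ G ⊛ F
⊛-comm F G r i = begin
  sumℤ (suc r) (λ j → sumℤ (suc i) (λ k → F j k * G (r ∸ j) (i ∸ k)))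
    ≡⟨ sum-reverse r _ ⟩
  sumℤ (suc r) (λ j → sumℤ (suc i) (λ k → F (r ∸ j) k * G (r ∸ (r ∸ j)) (i ∸ k)))
    ≡⟨ sum-cong (suc r) (λ j _ → sum-reverse i _) ⟩
  sumℤ (suc r) (λ j → sumℤ (suc i) (λ k → F (r ∸ j) (i ∸ k) * G (r ∸ (r ∸ j)) (i ∸ (i ∸ k))))
    ≡⟨ sum-cong (suc r) (λ j j≤r → sum-cong (suc i) (λ k k≤i →
         trans (cong₂ (λ a b → F (r ∸ j) (i ∸ k) * G a b) (∸-∸ j≤r) (∸-∸ k≤i))
               (ℤP.*-comm (F (r ∸ j) (i ∸ k)) (G j k)))) ⟩
  sumℤ (suc r) (λ j → sumℤ (suc i) (λ k → G j k * F (r ∸ j) (i ∸ k))) ∎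
  where
  open ≡-Reasoning
  ∸-∸ : ∀ {n j} → j < suc n → n ∸ (n ∸ j) ≡ j
  ∸-∸ j≤n = ℕP.m∸[m∸n]≡n (ℕP.≤-pred j≤n)

⊛-assoc : ∀ F G H → (F ⊛ G) ⊛ H ≈ F ⊛ (G ⊛ H)
⊛-assoc F G H r i = sym (begin
  sumℤ (suc r) (λ j → sumℤ (suc i) (λ k → F j k *
    sumℤ (suc (r ∸ j)) (λ j′ → sumℤ (suc (i ∸ k)) (λ k′ → G j′ k′ * H (r ∸ j ∸ j′) (i ∸ k ∸ k′)))))
    ≡⟨ sum-cong (suc r) (λ j _ → sum-cong (suc i) (λ k _ → trans (*-distribˡ-sum (suc (r ∸ j)) (F j k) _)
         (sum-cong (suc (r ∸ j)) (λ j′ _ → *-distribˡ-sum (suc (i ∸ k)) (F j k) _)))) ⟩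
  sumℤ (suc r) (λ j → sumℤ (suc i) (λ k → sumℤ (suc (r ∸ j)) (λ j′ → sumℤ (suc (i ∸ k)) (φ j k j′))))
    ≡⟨ sum-cong (suc r) (λ j _ → sum-comm (suc i) (suc (r ∸ j)) _) ⟩
  sumℤ (suc r) (λ j → sumℤ (suc (r ∸ j)) (λ j′ → sumℤ (suc i) (λ k → sumℤ (suc (i ∸ k)) (φ j k j′))))
    ≡⟨ sum-triangle r _ ⟩
  sumℤ (suc r) (λ s → sumℤ (suc s) (λ j → sumℤ (suc i) (λ k → sumℤ (suc (i ∸ k)) (φ j k (s ∸ j)))))
    ≡⟨ sum-cong (suc r) (λ s _ → sum-cong (suc s) (λ j _ → sum-triangle i _)) ⟩
  sumℤ (suc r) (λ s → sumℤ (suc s) (λ j → sumℤ (suc i) (λ t → sumℤ (suc t) (λ k → φ j k (s ∸ j) (t ∸ k)))))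
    ≡⟨ sum-cong (suc r) (λ s _ → sum-comm (suc s) (suc i) _) ⟩
  sumℤ (suc r) (λ s → sumℤ (suc i) (λ t → sumℤ (suc s) (λ j → sumℤ (suc t) (λ k → φ j k (s ∸ j) (t ∸ k)))))
    ≡⟨ sum-cong (suc r) (λ s _ → sum-cong (suc i) (λ t _ → sum-cong (suc s) (λ j j≤s →
         sum-cong (suc t) (λ k k≤t →
           trans (cong₂ (λ a b → F j k * (G (s ∸ j) (t ∸ k) * H a b)) (∸-∸ r j≤s) (∸-∸ i k≤t))
                 (sym (ℤP.*-assoc (F j k) (G (s ∸ j) (t ∸ k)) (H (r ∸ s) (i ∸ t)))))))) ⟩
  sumℤ (suc r) (λ s → sumℤ (suc i) (λ t → sumℤ (suc s) (λ j → sumℤ (suc t) (λ k →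
    (F j k * G (s ∸ j) (t ∸ k)) * H (r ∸ s) (i ∸ t)))))
    ≡⟨ sum-cong (suc r) (λ s _ → sum-cong (suc i) (λ t _ →
         sym (trans (*-distribʳ-sum (suc s) (H (r ∸ s) (i ∸ t)) _)
                    (sum-cong (suc s) (λ j _ → *-distribʳ-sum (suc t) (H (r ∸ s) (i ∸ t)) _))))) ⟩
  sumℤ (suc r) (λ s → sumℤ (suc i) (λ t →
    sumℤ (suc s) (λ j → sumℤ (suc t) (λ k → F j k * G (s ∸ j) (t ∸ k))) * H (r ∸ s) (i ∸ t))) ∎)
  where
  open ≡-Reasoning
  φ : ℕ → ℕ → ℕ → ℕ → ℤ
  φ j k j′ k′ = F j k * (G j′ k′ * H (r ∸ j ∸ j′) (i ∸ k ∸ k′))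
  ∸-∸ : ∀ n {s j} → j < suc s → n ∸ j ∸ (s ∸ j) ≡ n ∸ s
  ∸-∸ n {s} {j} j≤s = trans (ℕP.∸-+-assoc n j (s ∸ j)) (cong (n ∸_) (ℕP.m+[n∸m]≡n (ℕP.≤-pred j≤s)))

⊛-distribˡ-⊕ : ∀ F G H → F ⊛ (G ⊕ H) ≈ (F ⊛ G) ⊕ (F ⊛ H)
⊛-distribˡ-⊕ F G H r i = trans
  (sum-cong (suc r) (λ j _ → trans (sum-cong (suc i) (λ k _ → ℤP.*-distribˡ-+ (F j k) _ _)) (sum-+ (suc i) _ _)))
  (sum-+ (suc r) _ _)

mono-≢ᶻ : ∀ {m n r i} → r ≢ m → mono m n r i ≡ + 0
mono-≢ᶻ {m} {n} {r} {i} r≢m with r ℕ.≟ m | i ℕ.≟ n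
... | yes r≡m | _     = contradiction r≡m r≢m
... | no _    | yes _ = refl
... | no _    | no _  = refl

mono-≢ʸ : ∀ {m n r i} → i ≢ n → mono m n r i ≡ + 0
mono-≢ʸ {m} {n} {r} {i} i≢n with r ℕ.≟ m | i ℕ.≟ n
... | _     | yes i≡n = contradiction i≡n i≢n
... | yes _ | no _    = refl
... | no _  | no _    = refl

mono-≡ : ∀ m n → mono m n m n ≡ + 1
mono-≡ m n rewrite ℕP.≟-diag {m} refl | ℕP.≟-diag {n} refl = refl

mono-⊛ : ∀ m n F → mono m n ⊛ F ≈ shift m n F
mono-⊛ m n F r i with m ℕ.≤? r | n ℕ.≤? i
... | yes m≤r | yes n≤i = begin
  (mono m n ⊛ F) r i
    ≡⟨ sum-single (suc r) m (s≤s m≤r) (λ j _ j≢m →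
         sum-zero (suc i) (λ k _ → cong (_* F (r ∸ j) (i ∸ k)) (mono-≢ᶻ {m} {n} {j} {k} j≢m))) ⟩
  sumℤ (suc i) (λ k → mono m n m k * F (r ∸ m) (i ∸ k))
    ≡⟨ sum-single (suc i) n (s≤s n≤i) (λ k _ k≢n →
         cong (_* F (r ∸ m) (i ∸ k)) (mono-≢ʸ {m} {n} {m} {k} k≢n)) ⟩
  mono m n m n * F (r ∸ m) (i ∸ n)
    ≡⟨ cong (_* F (r ∸ m) (i ∸ n)) (mono-≡ m n) ⟩
  + 1 * F (r ∸ m) (i ∸ n)
    ≡⟨ ℤP.*-identityˡ _ ⟩
  F (r ∸ m) (i ∸ n) ∎
  where open ≡-Reasoning
... | yes _ | no n≰i = sum-zero (suc r) (λ j _ → sum-zero (suc i) (λ k k≤i → cong (_* F (r ∸ j) (i ∸ k))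
  (mono-≢ʸ {m} {n} {j} {k} (λ k≡n → n≰i (subst (_≤ i) k≡n (ℕP.≤-pred k≤i))))))
... | no m≰r | _ = sum-zero (suc r) (λ j j≤r → sum-zero (suc i) (λ k _ → cong (_* F (r ∸ j) (i ∸ k))
  (mono-≢ᶻ {m} {n} {j} {k} (λ j≡m → m≰r (subst (_≤ r) j≡m (ℕP.≤-pred j≤r))))))

⊛-commutativeRing : CommutativeRing 0ℓ 0ℓ
⊛-commutativeRing = record
  { Carrier = PS ; _≈_ = _≈_ ; _+_ = _⊕_ ; _*_ = _⊛_ ; -_ = ⊖_ ; 0# = 0PS ; 1# = one
  ; isCommutativeRing = record
    { isRing = record
      { +-isAbelianGroup = record
        { isGroup = record
          { isMonoid = record
            { isSemigroup = record
              { isMagma = record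
                { isEquivalence = record
                  { refl = λ _ _ → refl ; sym = λ p r i → sym (p r i) ; trans = λ p q r i → trans (p r i) (q r i) }
                ; ∙-cong = λ p q r i → cong₂ _+_ (p r i) (q r i) }
              ; assoc = λ F G H r i → ℤP.+-assoc (F r i) (G r i) (H r i) }
            ; identity = (λ F r i → ℤP.+-identityˡ (F r i)) , (λ F r i → ℤP.+-identityʳ (F r i)) }
          ; inverse = (λ F r i → ℤP.+-inverseˡ (F r i)) , (λ F r i → ℤP.+-inverseʳ (F r i))
          ; ⁻¹-cong = λ p r i → cong -_ (p r i) }
        ; comm = λ F G r i → ℤP.+-comm (F r i) (G r i) }
      ; *-cong = ⊛-cong
      ; *-assoc = ⊛-assoc
      ; *-identity = one-⊛ , (λ F r i → trans (⊛-comm F one r i) (one-⊛ F r i))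
      ; distrib = ⊛-distribˡ-⊕ , (λ F G H r i → trans (⊛-comm (G ⊕ H) F r i)
                    (trans (⊛-distribˡ-⊕ F G H r i) (cong₂ _+_ (⊛-comm F G r i) (⊛-comm F H r i))))
      }
    ; *-comm = ⊛-comm
    }
  }
  where
  one-⊛ : ∀ F → one ⊛ F ≈ F
  one-⊛ = mono-⊛ 0 0

module PS-Ring = CommutativeRing ⊛-commutativeRing
open PS-Ring
  using (+-cong; +-congˡ; +-congʳ; *-congˡ; *-congʳ; -‿cong; *-assoc; *-comm; *-identityˡ; distribʳ; zeroˡ; zeroʳ)
  renaming (refl to ≈-refl; sym to ≈-sym; trans to ≈-trans)

module ≈-Reasoning = Relation.Binary.Reasoning.Setoid PS-Ring.setoid

-- The clause for + 1 makes the solver's constant 1 reduce to one itself.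
ι : ℤ → PS
ι (+ 1) = one
ι a r i = a * one r i

ι-≈ : ∀ a → ι a ≈ λ r i → a * one r i
ι-≈ (+ 1)           r i = sym (ℤP.*-identityˡ (one r i))
ι-≈ (+ 0)           r i = refl
ι-≈ (+ suc (suc n)) r i = refl
ι-≈ -[1+ n ]        r i = refl

module PS-Solver where
  open import Algebra.Bundles using (RawRing)
  open import Algebra.Solver.Ring.AlmostCommutativeRing
    using (AlmostCommutativeRing; fromCommutativeRing; _-Raw-AlmostCommutative⟶_)
  open import Data.Maybe using (Maybe; nothing; just)
  import Algebra.Solver.Ring as Solver

  ℤ-rawRing : RawRing 0ℓ 0ℓ
  ℤ-rawRing = CommutativeRing.rawRing ℤP.+-*-commutativeRing

  PS-almostRing : AlmostCommutativeRing 0ℓ 0ℓ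
  PS-almostRing = fromCommutativeRing ⊛-commutativeRing

  ι-⊛ : ∀ a F → ι a ⊛ F ≈ λ r i → a * F r i
  ι-⊛ a F r i = begin
    (ι a ⊛ F) r i
      ≡⟨ ⊛-cong {G = F} (ι-≈ a) (λ _ _ → refl) r i ⟩
    sumℤ (suc r) (λ j → sumℤ (suc i) (λ k → a * one j k * F (r ∸ j) (i ∸ k)))
      ≡⟨ sum-cong (suc r) (λ j _ → trans (sum-cong (suc i) (λ k _ → ℤP.*-assoc a (one j k) _))
                                         (sym (*-distribˡ-sum (suc i) a _))) ⟩
    sumℤ (suc r) (λ j → a * sumℤ (suc i) (λ k → one j k * F (r ∸ j) (i ∸ k)))
      ≡⟨ sym (*-distribˡ-sum (suc r) a _) ⟩
    a * (one ⊛ F) r i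
      ≡⟨ cong (a *_) (mono-⊛ 0 0 F r i) ⟩
    a * F r i ∎
    where open ≡-Reasoning

  ι-morphism : ℤ-rawRing -Raw-AlmostCommutative⟶ PS-almostRing
  ι-morphism = record
    { ⟦_⟧    = ι
    ; +-homo = λ a b r i → trans (ι-≈ (a + b) r i) (trans (ℤP.*-distribʳ-+ (one r i) a b)
                             (sym (cong₂ _+_ (ι-≈ a r i) (ι-≈ b r i))))
    ; *-homo = λ a b r i → trans (ι-≈ (a * b) r i) (trans (ℤP.*-assoc a b (one r i))
                             (sym (trans (ι-⊛ a (ι b) r i) (cong (a *_) (ι-≈ b r i)))))
    ; -‿homo = λ a r i → trans (ι-≈ (- a) r i)
                           (trans (sym (ℤP.neg-distribˡ-* a (one r i))) (cong -_ (sym (ι-≈ a r i))))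
    ; 0-homo = λ r i → trans (ι-≈ (+ 0) r i) (ℤP.*-zeroˡ (one r i))
    ; 1-homo = λ r i → refl
    }

  ι-≟ : ∀ a b → Maybe (ι a ≈ ι b)
  ι-≟ a b with a ℤ.≟ b
  ... | yes refl = just (λ _ _ → refl)
  ... | no _     = nothing

  open Solver ℤ-rawRing PS-almostRing ι-morphism ι-≟ public

open PS-Solver using (solve; _:=_; _:+_; _:-_; _:*_; con)

one⊝X-⊛ : ∀ X F → (one ⊝ X) ⊛ F ≈ F ⊝ (X ⊛ F)
one⊝X-⊛ = solve 2 (λ X F → (con (+ 1) :- X) :* F := F :- (X :* F)) ≈-refl

fixpoint-⊛ : ∀ {F G X} → F ≈ G ⊕ (X ⊛ F) → (one ⊝ X) ⊛ F ≈ G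
fixpoint-⊛ {F} {G} {X} F≈G+XF = begin
  (one ⊝ X) ⊛ F                  ≈⟨ one⊝X-⊛ X F ⟩
  F ⊝ (X ⊛ F)                    ≈⟨ +-congʳ F≈G+XF ⟩
  (G ⊕ (X ⊛ F)) ⊝ (X ⊛ F)        ≈⟨ solve 2 (λ G XF → (G :+ XF) :- XF := G) ≈-refl G (X ⊛ F) ⟩
  G                              ∎
  where open ≈-Reasoning

geomZ : PS
geomZ e zero    = + 1
geomZ e (suc j) = + 0

geomZ-equation : geomZ ≈ one ⊕ (z ⊛ geomZ)
geomZ-equation r i = trans (pointwise r i) (cong (λ t → one r i + t) (sym (mono-⊛ 1 0 geomZ r i)))
  where
  pointwise : ∀ r i → geomZ r i ≡ one r i + shift 1 0 geomZ r i
  pointwise zero    zero    = refl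
  pointwise zero    (suc i) = refl
  pointwise (suc r) zero    = refl
  pointwise (suc r) (suc i) = refl

y-recursion-unique : ∀ {A F G : ℕ → PS} →
  (∀ b → F b ≈ A b ⊕ (yPS ⊛ F (suc b))) → (∀ b → G b ≈ A b ⊕ (yPS ⊛ G (suc b))) →
  ∀ b → F b ≈ G b
y-recursion-unique {A} {F} {G} F-eq G-eq b r i =
  trans (F-eq b r i) (trans (cong (λ t → A b r i + t) (tails i)) (sym (G-eq b r i)))
  where
  tails : ∀ i → (yPS ⊛ F (suc b)) r i ≡ (yPS ⊛ G (suc b)) r i
  tails zero    = trans (mono-⊛ 0 1 (F (suc b)) r zero) (sym (mono-⊛ 0 1 (G (suc b)) r zero))
  tails (suc i) = trans (mono-⊛ 0 1 (F (suc b)) r (suc i))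
    (trans (y-recursion-unique {A} F-eq G-eq (suc b) r i) (sym (mono-⊛ 0 1 (G (suc b)) r (suc i))))

z-recursion-unique : ∀ {A F G : ℕ → PS} →
  (∀ a → F a ≈ A a ⊕ (z ⊛ F (suc a))) → (∀ a → G a ≈ A a ⊕ (z ⊛ G (suc a))) →
  ∀ a → F a ≈ G a
z-recursion-unique {A} {F} {G} F-eq G-eq a r i =
  trans (F-eq a r i) (trans (cong (λ t → A a r i + t) (tails r)) (sym (G-eq a r i)))
  where
  tails : ∀ r → (z ⊛ F (suc a)) r i ≡ (z ⊛ G (suc a)) r i
  tails zero    = trans (mono-⊛ 1 0 (F (suc a)) zero i) (sym (mono-⊛ 1 0 (G (suc a)) zero i))
  tails (suc r) = trans (mono-⊛ 1 0 (F (suc a)) (suc r) i)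
    (trans (z-recursion-unique {A} F-eq G-eq (suc a) r i) (sym (mono-⊛ 1 0 (G (suc a)) (suc r) i)))

indicator : Bool → ℕ
indicator true  = 1
indicator false = 0

count : ∀ {A : Set} → (A → Bool) → List A → ℕ
count p []       = 0
count p (x ∷ xs) = indicator (p x) ℕ.+ count p xs

length-filter≡count : ∀ {p} {A : Set} {P : A → Set p} (P? : Decidable P) xs →
                      length (filter P? xs) ≡ count (does ∘ P?) xs
length-filter≡count P? []       = refl
length-filter≡count P? (x ∷ xs) with does (P? x)
... | true  = cong suc (length-filter≡count P? xs)
... | false = length-filter≡count P? xs

count-cong : ∀ {A : Set} {p q : A → Bool} xs → (∀ x → p x ≡ q x) → count p xs ≡ count q xs
count-cong []       p≗q = refl
count-cong (x ∷ xs) p≗q = cong₂ ℕ._+_ (cong indicator (p≗q x)) (count-cong xs p≗q)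

count-false : ∀ {A : Set} {p : A → Bool} xs → (∀ x → p x ≡ false) → count p xs ≡ 0
count-false []       p≗false = refl
count-false (x ∷ xs) p≗false = cong₂ ℕ._+_ (cong indicator (p≗false x)) (count-false xs p≗false)

does-all? : ∀ {A : Set} {P : A → Set} (P? : Decidable P) (p : A → Bool) →
            (∀ x → does (P? x) ≡ p x) → ∀ xs → does (all? P? xs) ≡ all p xs
does-all? P? p P?≗p []       = refl
does-all? P? p P?≗p (x ∷ xs) = cong₂ _∧_ (P?≗p x) (does-all? P? p P?≗p xs)

count-allWords-suc : ∀ (p : Word → Bool) n →
  count p (allWords (suc n)) ≡ count (p ∘ (false ∷_)) (allWords n) ℕ.+ count (p ∘ (true ∷_)) (allWords n)
count-allWords-suc p n = go (allWords n)
  where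
  go : ∀ ws → count p (concatMap (λ w → (false ∷ w) ∷ (true ∷ w) ∷ []) ws)
            ≡ count (p ∘ (false ∷_)) ws ℕ.+ count (p ∘ (true ∷_)) ws
  go []       = refl
  go (w ∷ ws) = begin
    a ℕ.+ (b ℕ.+ count p (concatMap _ ws))        ≡⟨ cong (λ t → a ℕ.+ (b ℕ.+ t)) (go ws) ⟩
    a ℕ.+ (b ℕ.+ (count p₀ ws ℕ.+ count p₁ ws))    ≡⟨ sym (ℕP.+-assoc a b _) ⟩
    (a ℕ.+ b) ℕ.+ (count p₀ ws ℕ.+ count p₁ ws)    ≡⟨ CSP.interchange ℕP.+-commutativeSemigroup a b _ _ ⟩
    (a ℕ.+ count p₀ ws) ℕ.+ (b ℕ.+ count p₁ ws)    ∎
    where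
    open ≡-Reasoning
    a b : ℕ
    a = indicator (p (false ∷ w))
    b = indicator (p (true ∷ w))
    p₀ p₁ : Word → Bool
    p₀ = p ∘ (false ∷_)
    p₁ = p ∘ (true ∷_)

#words : (Word → Bool) → ℕ → ℕ → ℕ
#words p zero    zero    = indicator (p [])
#words p (suc r) zero    = #words (p ∘ (false ∷_)) r zero
#words p zero    (suc i) = #words (p ∘ (true ∷_)) zero i
#words p (suc r) (suc i) = #words (p ∘ (false ∷_)) r (suc i) ℕ.+ #words (p ∘ (true ∷_)) (suc r) i

#words-false : ∀ r i → #words (λ _ → false) r i ≡ 0
#words-false zero    zero    = refl
#words-false (suc r) zero    = #words-false r zero
#words-false zero    (suc i) = #words-false zero i
#words-false (suc r) (suc i) = cong₂ ℕ._+_ (#words-false r (suc i)) (#words-false (suc r) i)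

count-allWords : ∀ n r i → r ℕ.+ i ≡ n → ∀ (p : Word → Bool) →
                 count (λ w → p w ∧ ((#0 w ≡ᵇ r) ∧ (#1 w ≡ᵇ i))) (allWords n) ≡ #words p r i
count-allWords zero    zero    zero    _ p = trans (ℕP.+-identityʳ _) (cong indicator (∧-identityʳ (p [])))
count-allWords (suc n) (suc r) zero    e p = trans (count-allWords-suc _ n)
  (trans (cong₂ ℕ._+_ (count-allWords n r zero (ℕP.suc-injective e) (p ∘ (false ∷_)))
                      (count-false (allWords n) λ v → trans (cong (p (true ∷ v) ∧_) (∧-zeroʳ _)) (∧-zeroʳ _)))
         (ℕP.+-identityʳ _))
count-allWords (suc n) zero    (suc i) e p = trans (count-allWords-suc _ n)
  (cong₂ ℕ._+_ (count-false (allWords n) (λ v → ∧-zeroʳ (p (false ∷ v))))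
               (count-allWords n zero i (ℕP.suc-injective e) (p ∘ (true ∷_))))
count-allWords (suc n) (suc r) (suc i) e p = trans (count-allWords-suc _ n)
  (cong₂ ℕ._+_ (count-allWords n r (suc i) (ℕP.suc-injective e) (p ∘ (false ∷_)))
               (count-allWords n (suc r) i (trans (sym (ℕP.+-suc r i)) (ℕP.suc-injective e))
                                           (p ∘ (true ∷_))))

wordSeries : (Word → Bool) → PS
wordSeries p r i = + #words p r i

wordSeries-split : ∀ p → wordSeries p ≈
  ((if p [] then one else 0PS) ⊕ (z ⊛ wordSeries (p ∘ (false ∷_)))) ⊕ (yPS ⊛ wordSeries (p ∘ (true ∷_)))
wordSeries-split p r i = trans (pointwise r i)
  (sym (cong₂ (λ a b → ((if p [] then one else 0PS) r i + a) + b) (mono-⊛ 1 0 W₀ r i) (mono-⊛ 0 1 W₁ r i)))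
  where
  W₀ W₁ : PS
  W₀ = wordSeries (p ∘ (false ∷_))
  W₁ = wordSeries (p ∘ (true ∷_))
  pointwise : ∀ r i →
    wordSeries p r i ≡ ((if p [] then one else 0PS) r i + shift 1 0 W₀ r i) + shift 0 1 W₁ r i
  pointwise zero    zero    with p []
  ... | true  = refl
  ... | false = refl
  pointwise (suc r) zero    with p []
  ... | true  = sym (ℤP.+-identityʳ _)
  ... | false = sym (ℤP.+-identityʳ _)
  pointwise zero    (suc i) with p []
  ... | true  = refl
  ... | false = refl
  pointwise (suc r) (suc i) with p []
  ... | true  = refl
  ... | false = refl

mono-indicator : ∀ m n e j → mono m n e j ≡ + indicator ((e ≡ᵇ m) ∧ (j ≡ᵇ n))
mono-indicator m n e j with e ℕ.≟ m | j ℕ.≟ n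
... | yes e≡m | yes j≡n = cong (+_ ∘ indicator) (sym (cong₂ _∧_ (dec-true (e ℕ.≟ m) e≡m) (dec-true (j ℕ.≟ n) j≡n)))
... | yes _   | no j≢n  = cong (+_ ∘ indicator) (sym (trans (cong ((e ≡ᵇ m) ∧_) (dec-false (j ℕ.≟ n) j≢n)) (∧-zeroʳ _)))
... | no e≢m  | _       = cong (+_ ∘ indicator) (sym (cong (_∧ (j ≡ᵇ n)) (dec-false (e ℕ.≟ m) e≢m)))

graph : (ℕ → ℕ) → (ℕ → Bool) → PS
graph g S e j = + indicator ((g j ≡ᵇ e) ∧ S j)

epigraph : (ℕ → ℕ) → (ℕ → Bool) → PS
epigraph g S e j = + indicator ((g j <ᵇ suc e) ∧ S j)

graph-cong : ∀ g {S T} → (∀ j → S j ≡ T j) → graph g S ≈ graph g T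
graph-cong g S≗T e j = cong (λ t → + indicator ((g j ≡ᵇ e) ∧ t)) (S≗T j)

epigraph-difference : ∀ g S → (one ⊝ z) ⊛ epigraph g S ≈ graph g S
epigraph-difference g S e j = begin
  ((one ⊝ z) ⊛ E) e j             ≡⟨ one⊝X-⊛ z E e j ⟩
  E e j - (z ⊛ E) e j             ≡⟨ cong (λ t → E e j - t) (mono-⊛ 1 0 E e j) ⟩
  E e j - shift 1 0 E e j         ≡⟨ pointwise e ⟩
  graph g S e j                   ∎
  where
  open ≡-Reasoning
  E : PS
  E = epigraph g S
  step : ∀ n e s → + indicator ((n <ᵇ suc (suc e)) ∧ s) - + indicator ((n <ᵇ suc e) ∧ s)
                   ≡ + indicator ((n ≡ᵇ suc e) ∧ s)
  step zero          e       s = ℤP.+-inverseʳ (+ indicator s)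
  step (suc zero)    zero    s = ℤP.+-identityʳ (+ indicator s)
  step (suc (suc n)) zero    s = refl
  step (suc n)       (suc e) s = step n e s
  pointwise : ∀ e → E e j - shift 1 0 E e j ≡ graph g S e j
  pointwise zero with g j
  ... | zero  = ℤP.+-identityʳ _
  ... | suc _ = ℤP.+-identityʳ _
  pointwise (suc e) = step (g j) e (S j)

mono-⊛-graph : ∀ m n g h S → (∀ k → h (n ℕ.+ k) ≡ m ℕ.+ g k) →
               mono m n ⊛ graph g S ≈ graph h (λ j → (n ≤ᵇ j) ∧ S (j ∸ n))
mono-⊛-graph m n g h S h≡m+g e j = trans (mono-⊛ m n (graph g S) e j) pointwise
  where
  k : ℕ
  k = j ∸ n
  hj≡m+gk : n ≤ j → h j ≡ m ℕ.+ g k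
  hj≡m+gk n≤j = trans (cong h (sym (ℕP.m+[n∸m]≡n n≤j))) (h≡m+g k)
  n≰j⇒zero : ¬ n ≤ j → graph h (λ j → (n ≤ᵇ j) ∧ S (j ∸ n)) e j ≡ + 0
  n≰j⇒zero n≰j = cong (+_ ∘ indicator)
    (trans (cong (λ t → (h j ≡ᵇ e) ∧ (t ∧ S k)) (dec-false (n ℕ.≤? j) n≰j)) (∧-zeroʳ (h j ≡ᵇ e)))
  pointwise : shift m n (graph g S) e j ≡ graph h (λ j → (n ≤ᵇ j) ∧ S (j ∸ n)) e j
  pointwise with m ℕ.≤? e | n ℕ.≤? j
  ... | yes m≤e | yes n≤j = cong (+_ ∘ indicator) (begin
    (g k ≡ᵇ e ∸ m) ∧ S k          ≡⟨ cong (_∧ S k) (does-⇔ (mk⇔ to from) (g k ℕ.≟ e ∸ m) (h j ℕ.≟ e)) ⟩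
    (h j ≡ᵇ e) ∧ S k              ≡⟨ cong (λ t → (h j ≡ᵇ e) ∧ (t ∧ S k)) (sym (dec-true (n ℕ.≤? j) n≤j)) ⟩
    (h j ≡ᵇ e) ∧ ((n ≤ᵇ j) ∧ S k) ∎)
    where
    open ≡-Reasoning
    to : g k ≡ e ∸ m → h j ≡ e
    to eq = trans (hj≡m+gk n≤j) (trans (cong (m ℕ.+_) eq) (ℕP.m+[n∸m]≡n m≤e))
    from : h j ≡ e → g k ≡ e ∸ m
    from eq = trans (sym (ℕP.m+n∸m≡n m (g k))) (cong (_∸ m) (trans (sym (hj≡m+gk n≤j)) eq))
  ... | yes _   | no n≰j  = sym (n≰j⇒zero n≰j)
  ... | no _    | no n≰j  = sym (n≰j⇒zero n≰j)
  ... | no m≰e  | yes n≤j = sym (cong (λ t → + indicator (t ∧ ((n ≤ᵇ j) ∧ S k))) (dec-false (h j ℕ.≟ e) λ hj≡e →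
    m≰e (subst (m ≤_) (trans (sym (hj≡m+gk n≤j)) hj≡e) (ℕP.m≤m+n m (g k)))))

z-⊛-graph : ∀ g S → z ⊛ graph g S ≈ graph (suc ∘ g) S
z-⊛-graph g S = mono-⊛-graph 1 0 g (suc ∘ g) S (λ _ → refl)

mono≈graph : ∀ g {m} n → g n ≡ m → mono m n ≈ graph g (_≡ᵇ n)
mono≈graph g {m} n gn≡m e j = trans (mono-indicator m n e j)
  (cong (+_ ∘ indicator) (does-⇔ (mk⇔ to from) (e ℕ.≟ m ×-dec j ℕ.≟ n) (g j ℕ.≟ e ×-dec j ℕ.≟ n)))
  where
  to : e ≡ m × j ≡ n → g j ≡ e × j ≡ n
  to (refl , refl) = gn≡m , refl
  from : g j ≡ e × j ≡ n → e ≡ m × j ≡ n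
  from (refl , refl) = gn≡m , refl

sumPS-mono≈graph : ∀ g n → sumPS n (λ i → mono (g i) i) ≈ graph g (_<ᵇ n)
sumPS-mono≈graph g zero    e j = cong (+_ ∘ indicator) (sym (∧-zeroʳ (g j ≡ᵇ e)))
sumPS-mono≈graph g (suc n) e j =
  trans (cong₂ _+_ (sumPS-mono≈graph g n e j) (mono≈graph g n refl e j)) (pointwise (g j ≡ᵇ e))
  where
  <-or-≡ : ∀ j n → + indicator (j <ᵇ n) + + indicator (j ≡ᵇ n) ≡ + indicator (j <ᵇ suc n)
  <-or-≡ zero    zero    = refl
  <-or-≡ zero    (suc n) = refl
  <-or-≡ (suc j) zero    = refl
  <-or-≡ (suc j) (suc n) = <-or-≡ j n
  pointwise : ∀ x → + indicator (x ∧ (j <ᵇ n)) + + indicator (x ∧ (j ≡ᵇ n)) ≡ + indicator (x ∧ (j <ᵇ suc n))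
  pointwise true  = <-or-≡ j n
  pointwise false = refl

graph-interval : ∀ g c .{{_ : NonZero c}} →
  graph g (0 <ᵇ_) ⊝ graph g (c <ᵇ_) ≈ (graph g (_<ᵇ c) ⊝ graph g (_≡ᵇ 0)) ⊕ graph g (_≡ᵇ c)
graph-interval g (suc c) e j with g j ≡ᵇ e
... | false = refl
... | true  = pointwise j
  where
  trichotomy : ∀ j c → + 1 - + indicator (c <ᵇ j) ≡ (+ indicator (j <ᵇ c) - + 0) + + indicator (j ≡ᵇ c)
  trichotomy zero    zero    = refl
  trichotomy zero    (suc c) = refl
  trichotomy (suc j) zero    = refl
  trichotomy (suc j) (suc c) = trichotomy j c
  pointwise : ∀ j → + indicator (0 <ᵇ j) - + indicator (suc c <ᵇ j)
                  ≡ (+ indicator (j <ᵇ suc c) - + indicator (j ≡ᵇ 0)) + + indicator (j ≡ᵇ suc c)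
  pointwise zero    = refl
  pointwise (suc j) = trichotomy j c

m<n*o⇔m/o<n : ∀ {m n o} .{{_ : NonZero o}} → m < n ℕ.* o ⇔ m / o < n
m<n*o⇔m/o<n {m} {n} {o} = mk⇔ m<n*o⇒m/o<n from
  where
  from : m / o < n → m < n ℕ.* o
  from m/o<n = begin-strict
    m                       ≡⟨ m≡m%n+[m/n]*n m o ⟩
    m % o ℕ.+ m / o ℕ.* o   <⟨ ℕP.+-monoˡ-< (m / o ℕ.* o) (m%n<n m o) ⟩
    o ℕ.+ m / o ℕ.* o       ≤⟨ ℕP.*-monoˡ-≤ o m/o<n ⟩
    n ℕ.* o                 ∎
    where open ℕP.≤-Reasoning

module _ (c d : ℕ) .{{_ : NonZero c}} where

  good : ℕ × ℕ → Bool
  good (a , b) = b ℕ.* d <ᵇ a ℕ.* c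

  accepted : Word → Bool
  accepted w = all good (maxFactors w)

  W : PS
  W = wordSeries accepted

  Wq≈W : Wq c d ≈ W
  Wq≈W r i = cong +_ (begin
    wCount c d r i
      ≡⟨ length-filter≡count _ (allWords (r ℕ.+ i)) ⟩
    count (λ w → does (InW? c d w) ∧ ((#0 w ≡ᵇ r) ∧ (#1 w ≡ᵇ i))) (allWords (r ℕ.+ i))
      ≡⟨ count-cong (allWords (r ℕ.+ i))
                    (λ w → cong (_∧ _) (does-all? _ good (λ _ → refl) (maxFactors w))) ⟩
    count (λ w → accepted w ∧ ((#0 w ≡ᵇ r) ∧ (#1 w ≡ᵇ i))) (allWords (r ℕ.+ i))
      ≡⟨ count-allWords (r ℕ.+ i) r i refl accepted ⟩
    #words accepted r i ∎)
    where open ≡-Reasoning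

  afterZeros : ℕ → PS
  afterZeros a = wordSeries (λ v → all good (inZeros a v))

  afterOnes : ℕ → ℕ → PS
  afterOnes a b = wordSeries (λ v → all good (inOnes a b v))

  U : PS
  U = one ⊕ (z ⊛ afterZeros 1)

  W-equation : W ≈ U ⊕ (yPS ⊛ W)
  W-equation = wordSeries-split accepted

  afterZeros-equation : ∀ a →
    afterZeros (suc a) ≈ (one ⊕ (z ⊛ afterZeros (suc (suc a)))) ⊕ (yPS ⊛ afterOnes (suc a) 1)
  afterZeros-equation a = subst
    (λ t → afterZeros (suc a) ≈ ((if t then one else 0PS) ⊕ (z ⊛ afterZeros (suc (suc a)))) ⊕ (yPS ⊛ afterOnes (suc a) 1))
    zero-run-is-good (wordSeries-split _)
    where
    zero-run-is-good : good (suc a , 0) ∧ true ≡ true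
    zero-run-is-good = trans (∧-identityʳ _)
      (dec-true (0 ℕ.<? suc a ℕ.* c) (ℕP.<-≤-trans (ℕ.>-nonZero⁻¹ c) (ℕP.m≤m+n c (a ℕ.* c))))

  afterOnes-equation : ∀ a b → afterOnes a b ≈ (if good (a , b) then U else 0PS) ⊕ (yPS ⊛ afterOnes a (suc b))
  afterOnes-equation a b r i =
    trans (wordSeries-split _ r i) (cong (_+ (yPS ⊛ afterOnes a (suc b)) r i) (closed-run (good (a , b)) r i))
    where
    closed-run : ∀ g → (if g ∧ true then one else 0PS) ⊕ (z ⊛ wordSeries (λ v → g ∧ all good (inZeros 1 v)))
                     ≈ (if g then U else 0PS)
    closed-run true  = ≈-refl
    closed-run false r i = trans (ℤP.+-identityˡ _)
      (trans (⊛-cong {z} {z} ≈-refl (λ r i → cong +_ (#words-false r i)) r i) (zeroʳ z r i))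

  onesTail : ℕ → ℕ → PS
  onesTail a b zero    j = + indicator (good (a , b ℕ.+ j))
  onesTail a b (suc e) j = + 0

  onesTail-equation : ∀ a b → onesTail a b ≈ (if good (a , b) then one else 0PS) ⊕ (yPS ⊛ onesTail a (suc b))
  onesTail-equation a b r i = trans (pointwise r i)
    (cong (λ t → (if good (a , b) then one else 0PS) r i + t) (sym (mono-⊛ 0 1 (onesTail a (suc b)) r i)))
    where
    pointwise : ∀ r i →
      onesTail a b r i ≡ (if good (a , b) then one else 0PS) r i + shift 0 1 (onesTail a (suc b)) r i
    pointwise zero zero rewrite ℕP.+-identityʳ b with good (a , b)
    ... | true  = refl
    ... | false = refl
    pointwise zero (suc i) rewrite ℕP.+-suc b i with good (a , b)
    ... | true  = refl
    ... | false = refl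
    pointwise (suc r) zero with good (a , b)
    ... | true  = refl
    ... | false = refl
    pointwise (suc r) (suc i) with good (a , b)
    ... | true  = refl
    ... | false = refl

  afterOnes-closed : ∀ a b → afterOnes a b ≈ onesTail a b ⊛ U
  afterOnes-closed a = y-recursion-unique {λ b → if good (a , b) then U else 0PS}
                                         (afterOnes-equation a) onesTail⊛U-equation
    where
    open ≈-Reasoning
    select-⊛ : ∀ g → (if g then one else 0PS) ⊛ U ≈ (if g then U else 0PS)
    select-⊛ true  = *-identityˡ U
    select-⊛ false = zeroˡ U
    onesTail⊛U-equation : ∀ b →
      onesTail a b ⊛ U ≈ (if good (a , b) then U else 0PS) ⊕ (yPS ⊛ (onesTail a (suc b) ⊛ U))
    onesTail⊛U-equation b = begin
      onesTail a b ⊛ U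
        ≈⟨ *-congʳ {U} (onesTail-equation a b) ⟩
      ((if good (a , b) then one else 0PS) ⊕ (yPS ⊛ onesTail a (suc b))) ⊛ U
        ≈⟨ distribʳ U (if good (a , b) then one else 0PS) (yPS ⊛ onesTail a (suc b)) ⟩
      ((if good (a , b) then one else 0PS) ⊛ U) ⊕ ((yPS ⊛ onesTail a (suc b)) ⊛ U)
        ≈⟨ +-cong (select-⊛ (good (a , b))) (*-assoc yPS (onesTail a (suc b)) U) ⟩
      (if good (a , b) then U else 0PS) ⊕ (yPS ⊛ (onesTail a (suc b) ⊛ U)) ∎

  goodBlocks : ℕ → PS
  goodBlocks a e zero    = + 0
  goodBlocks a e (suc j) = + indicator (good (a ℕ.+ e , suc j))

  goodBlocks-equation : ∀ a → goodBlocks a ≈ (yPS ⊛ onesTail a 1) ⊕ (z ⊛ goodBlocks (suc a))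
  goodBlocks-equation a r i = trans (pointwise r i)
    (sym (cong₂ _+_ (mono-⊛ 0 1 (onesTail a 1) r i) (mono-⊛ 1 0 (goodBlocks (suc a)) r i)))
    where
    pointwise : ∀ r i →
      goodBlocks a r i ≡ shift 0 1 (onesTail a 1) r i + shift 1 0 (goodBlocks (suc a)) r i
    pointwise zero    zero    = refl
    pointwise (suc r) zero    = refl
    pointwise zero    (suc i) rewrite ℕP.+-identityʳ a = sym (ℤP.+-identityʳ _)
    pointwise (suc r) (suc i) rewrite ℕP.+-suc a r = refl

  zerosSolution : ℕ → PS
  zerosSolution a = geomZ ⊕ (goodBlocks a ⊛ U)

  zerosSolution-equation : ∀ a →
    zerosSolution a ≈ (one ⊕ (yPS ⊛ (onesTail a 1 ⊛ U))) ⊕ (z ⊛ zerosSolution (suc a))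
  zerosSolution-equation a = begin
    geomZ ⊕ (goodBlocks a ⊛ U)
      ≈⟨ +-cong geomZ-equation (*-congʳ {U} (goodBlocks-equation a)) ⟩
    (one ⊕ (z ⊛ geomZ)) ⊕ (((yPS ⊛ onesTail a 1) ⊕ (z ⊛ goodBlocks (suc a))) ⊛ U)
      ≈⟨ solve 6 (λ G T Q V Y Z → (con (+ 1) :+ (Z :* G)) :+ (((Y :* T) :+ (Z :* Q)) :* V)
                              := (con (+ 1) :+ (Y :* (T :* V))) :+ (Z :* (G :+ (Q :* V))))
               ≈-refl geomZ (onesTail a 1) (goodBlocks (suc a)) U yPS z ⟩
    (one ⊕ (yPS ⊛ (onesTail a 1 ⊛ U))) ⊕ (z ⊛ zerosSolution (suc a)) ∎
    where open ≈-Reasoning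

  afterZeros-closed : ∀ a → afterZeros (suc a) ≈ zerosSolution (suc a)
  afterZeros-closed = z-recursion-unique {A} {afterZeros ∘ suc} {zerosSolution ∘ suc}
                                         afterZeros-recursion (zerosSolution-equation ∘ suc)
    where
    open ≈-Reasoning
    A : ℕ → PS
    A a = one ⊕ (yPS ⊛ (onesTail (suc a) 1 ⊛ U))
    afterZeros-recursion : ∀ a → afterZeros (suc a) ≈ A a ⊕ (z ⊛ afterZeros (suc (suc a)))
    afterZeros-recursion a = begin
      afterZeros (suc a)
        ≈⟨ afterZeros-equation a ⟩
      (one ⊕ (z ⊛ afterZeros (suc (suc a)))) ⊕ (yPS ⊛ afterOnes (suc a) 1)
        ≈⟨ +-congˡ {one ⊕ (z ⊛ afterZeros (suc (suc a)))} (*-congˡ {yPS} (afterOnes-closed (suc a) 1)) ⟩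
      (one ⊕ (z ⊛ afterZeros (suc (suc a)))) ⊕ (yPS ⊛ (onesTail (suc a) 1 ⊛ U))
        ≈⟨ CSP.xy∙z≈xz∙y PS-Ring.+-commutativeSemigroup one _ _ ⟩
      (one ⊕ (yPS ⊛ (onesTail (suc a) 1 ⊛ U))) ⊕ (z ⊛ afterZeros (suc (suc a))) ∎

  ⌊_/q⌋ : ℕ → ℕ
  ⌊ j /q⌋ = (j ℕ.* d) / c

  ⌊c/q⌋≡d : ⌊ c /q⌋ ≡ d
  ⌊c/q⌋≡d = trans (/-congˡ (ℕP.*-comm c d)) (m*n/n≡m d c)

  ⌊/q⌋-periodic : ∀ k → ⌊ c ℕ.+ k /q⌋ ≡ d ℕ.+ ⌊ k /q⌋
  ⌊/q⌋-periodic k = begin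
    ((c ℕ.+ k) ℕ.* d) / c          ≡⟨ /-congˡ (ℕP.*-distribʳ-+ d c k) ⟩
    (c ℕ.* d ℕ.+ k ℕ.* d) / c      ≡⟨ +-distrib-/-∣ˡ (k ℕ.* d) (m∣m*n d) ⟩
    ⌊ c /q⌋ ℕ.+ ⌊ k /q⌋            ≡⟨ cong (ℕ._+ ⌊ k /q⌋) ⌊c/q⌋≡d ⟩
    d ℕ.+ ⌊ k /q⌋                  ∎
    where open ≡-Reasoning

  Q : PS
  Q = goodBlocks 1

  Q≈epigraph : Q ≈ epigraph ⌊_/q⌋ (0 <ᵇ_)
  Q≈epigraph e zero    = cong (+_ ∘ indicator) (sym (∧-zeroʳ _))
  Q≈epigraph e (suc j) = cong (+_ ∘ indicator) (trans
    (does-⇔ m<n*o⇔m/o<n (suc j ℕ.* d ℕ.<? suc e ℕ.* c) (⌊ suc j /q⌋ ℕ.<? suc e)) (sym (∧-identityʳ _)))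

  M : PS
  M = mono d c

  M-⊛-graph : M ⊛ graph ⌊_/q⌋ (0 <ᵇ_) ≈ graph ⌊_/q⌋ (c <ᵇ_)
  M-⊛-graph = ≈-trans (mono-⊛-graph d c ⌊_/q⌋ ⌊_/q⌋ (0 <ᵇ_) ⌊/q⌋-periodic)
    (graph-cong ⌊_/q⌋ λ j → does-⇔ (mk⇔ to from) (c ℕ.≤? j ×-dec 0 ℕ.<? j ∸ c) (c ℕ.<? j))
    where
    to : ∀ {j} → c ≤ j × 0 < j ∸ c → c < j
    to (_ , 0<j∸c) = ℕP.≰⇒> λ j≤c → ℕP.<-irrefl refl (subst (0 <_) (ℕP.m≤n⇒m∸n≡0 j≤c) 0<j∸c)
    from : ∀ {j} → c < j → c ≤ j × 0 < j ∸ c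
    from c<j = ℕP.<⇒≤ c<j , ℕP.m<n⇒0<n∸m c<j

  lattice-identity : z ⊛ ((one ⊝ z) ⊛ ((one ⊝ M) ⊛ Q)) ≈ (Pq c d ⊝ z) ⊕ (z ⊛ M)
  lattice-identity = begin
    z ⊛ ((one ⊝ z) ⊛ ((one ⊝ M) ⊛ Q))
      ≈⟨ solve 3 (λ Z M Q → Z :* ((con (+ 1) :- Z) :* ((con (+ 1) :- M) :* Q))
                         := Z :* ((con (+ 1) :- M) :* ((con (+ 1) :- Z) :* Q))) ≈-refl z M Q ⟩
    z ⊛ ((one ⊝ M) ⊛ ((one ⊝ z) ⊛ Q))
      ≈⟨ *-congˡ {z} (*-congˡ {one ⊝ M}
           (≈-trans (*-congˡ {one ⊝ z} Q≈epigraph) (epigraph-difference ⌊_/q⌋ (0 <ᵇ_)))) ⟩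
    z ⊛ ((one ⊝ M) ⊛ graph ⌊_/q⌋ (0 <ᵇ_))
      ≈⟨ *-congˡ {z} (≈-trans (one⊝X-⊛ M (graph ⌊_/q⌋ (0 <ᵇ_))) (+-congˡ {graph ⌊_/q⌋ (0 <ᵇ_)} (-‿cong M-⊛-graph))) ⟩
    z ⊛ (graph ⌊_/q⌋ (0 <ᵇ_) ⊝ graph ⌊_/q⌋ (c <ᵇ_))
      ≈⟨ solve 3 (λ Z A B → Z :* (A :- B) := (Z :* A) :- (Z :* B))
                 ≈-refl z (graph ⌊_/q⌋ (0 <ᵇ_)) (graph ⌊_/q⌋ (c <ᵇ_)) ⟩
    (z ⊛ graph ⌊_/q⌋ (0 <ᵇ_)) ⊝ (z ⊛ graph ⌊_/q⌋ (c <ᵇ_))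
      ≈⟨ +-cong (z-⊛-graph ⌊_/q⌋ (0 <ᵇ_)) (-‿cong (z-⊛-graph ⌊_/q⌋ (c <ᵇ_))) ⟩
    graph h (0 <ᵇ_) ⊝ graph h (c <ᵇ_)
      ≈⟨ graph-interval h c ⟩
    (graph h (_<ᵇ c) ⊝ graph h (_≡ᵇ 0)) ⊕ graph h (_≡ᵇ c)
      ≈⟨ ≈-sym (+-cong (+-cong (sumPS-mono≈graph h c) (-‿cong (mono≈graph h 0 (cong suc (0/n≡0 c)))))
                       (≈-trans (*-congˡ {z} (mono≈graph ⌊_/q⌋ c ⌊c/q⌋≡d)) (z-⊛-graph ⌊_/q⌋ (_≡ᵇ c)))) ⟩
    (Pq c d ⊝ z) ⊕ (z ⊛ M) ∎
    where
    open ≈-Reasoning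
    h : ℕ → ℕ
    h = suc ∘ ⌊_/q⌋

  U-equation : (one ⊝ z) ⊛ U ≈ one ⊕ ((z ⊛ ((one ⊝ z) ⊛ Q)) ⊛ U)
  U-equation = begin
    (one ⊝ z) ⊛ (one ⊕ (z ⊛ afterZeros 1))
      ≈⟨ *-congˡ {one ⊝ z} (+-congˡ {one} (*-congˡ {z} (afterZeros-closed 0))) ⟩
    (one ⊝ z) ⊛ (one ⊕ (z ⊛ (geomZ ⊕ (Q ⊛ U))))
      ≈⟨ solve 4 (λ Z G Q V → (con (+ 1) :- Z) :* (con (+ 1) :+ (Z :* (G :+ (Q :* V))))
                           := (((con (+ 1) :- Z) :+ (Z :* ((con (+ 1) :- Z) :* G)))
                               :+ ((Z :* ((con (+ 1) :- Z) :* Q)) :* V)))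
                 ≈-refl z geomZ Q U ⟩
    ((one ⊝ z) ⊕ (z ⊛ ((one ⊝ z) ⊛ geomZ))) ⊕ ((z ⊛ ((one ⊝ z) ⊛ Q)) ⊛ U)
      ≈⟨ +-congʳ (+-congˡ {one ⊝ z} (*-congˡ {z} (fixpoint-⊛ {geomZ} {one} {z} geomZ-equation))) ⟩
    ((one ⊝ z) ⊕ (z ⊛ one)) ⊕ ((z ⊛ ((one ⊝ z) ⊛ Q)) ⊛ U)
      ≈⟨ +-congʳ (solve 1 (λ Z → (con (+ 1) :- Z) :+ (Z :* con (+ 1)) := con (+ 1)) ≈-refl z) ⟩
    one ⊕ ((z ⊛ ((one ⊝ z) ⊛ Q)) ⊛ U) ∎
    where open ≈-Reasoning

  U-identity : U ⊛ ((one ⊝ M) ⊝ Pq c d) ≈ one ⊝ M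
  U-identity = begin
    U ⊛ ((one ⊝ M) ⊝ Pq c d)
      ≈⟨ solve 4 (λ V M P Z → V :* ((con (+ 1) :- M) :- P)
                           := ((con (+ 1) :- M) :* ((con (+ 1) :- Z) :* V)) :- (V :* ((P :- Z) :+ (Z :* M))))
                 ≈-refl U M (Pq c d) z ⟩
    ((one ⊝ M) ⊛ ((one ⊝ z) ⊛ U)) ⊝ (U ⊛ ((Pq c d ⊝ z) ⊕ (z ⊛ M)))
      ≈⟨ +-cong (*-congˡ {one ⊝ M} U-equation) (-‿cong (*-congˡ {U} (≈-sym lattice-identity))) ⟩
    ((one ⊝ M) ⊛ (one ⊕ ((z ⊛ ((one ⊝ z) ⊛ Q)) ⊛ U))) ⊝ (U ⊛ (z ⊛ ((one ⊝ z) ⊛ ((one ⊝ M) ⊛ Q))))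
      ≈⟨ solve 4 (λ M Z Q V → ((con (+ 1) :- M) :* (con (+ 1) :+ ((Z :* ((con (+ 1) :- Z) :* Q)) :* V)))
                               :- (V :* (Z :* ((con (+ 1) :- Z) :* ((con (+ 1) :- M) :* Q))))
                           := con (+ 1) :- M)
                 ≈-refl M z Q U ⟩
    one ⊝ M ∎
    where open ≈-Reasoning

theorem1 : (c d : ℕ) → .{{_ : NonZero c}} → .{{_ : NonZero d}} → Coprime c d →
    ∀ r i → (Wq c d ⊛ ((one ⊝ yPS) ⊛ ((one ⊝ mono d c) ⊝ Pq c d))) r i
              ≡ (one ⊝ mono d c) r i
theorem1 c d _ = begin
  Wq c d ⊛ ((one ⊝ yPS) ⊛ R)    ≈⟨ *-congʳ {(one ⊝ yPS) ⊛ R} (Wq≈W c d) ⟩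
  W c d ⊛ ((one ⊝ yPS) ⊛ R)     ≈⟨ ≈-sym (*-assoc (W c d) (one ⊝ yPS) R) ⟩
  (W c d ⊛ (one ⊝ yPS)) ⊛ R     ≈⟨ *-congʳ {R} (*-comm (W c d) (one ⊝ yPS)) ⟩
  ((one ⊝ yPS) ⊛ W c d) ⊛ R     ≈⟨ *-congʳ {R} (fixpoint-⊛ {W c d} {U c d} {yPS} (W-equation c d)) ⟩
  U c d ⊛ R                     ≈⟨ U-identity c d ⟩
  one ⊝ mono d c                ∎
  where
  open ≈-Reasoning
  R : PS
  R = (one ⊝ mono d c) ⊝ Pq c d
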